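{- Let $r>2$ be an integer. Let $\mathcal Q$ be a set of size $r^2+1$ which is covered by a family $\{U_i: i=1,\ldots,r\}$ of $r$ subsets of $\mathcal Q$, each of size $r+1$, such that $|U_i\cap U_j|=1$ for all $i\neq j$. Then all the sets $U_i$ have one and the same common element, i.e. $|\bigcap_{i=1}^r U_i|=1$. -}

module Defs where

open import Data.Nat using (ℕ; _*_; suc)
open import Data.Fin using (Fin)
open import Data.Fin.Subset using (Subset; ⋂)
open import Data.List using (List)
open import Data.Vec.Functional using (toList)

-- Ground set Q of size r^2+1 is modelled as Fin (r * r + 1) (= Fin (suc (r * r))).
-- Intersection of the whole family U : Fin r → Subset m.
⋂ᶠ : ∀ {r m} → (Fin r → Subset m) → Subset m
⋂ᶠ U = ⋂ (toList U)

{-# OPTIONS --safe #-}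
-- Let q be the point shared by U₀ and U₁, so that |U₀ ∪ U₁| = 2r + 1. Each of the
-- remaining r − 2 sets has r + 1 points and meets U₀ ∪ U₁, so it adds at most r new
-- points; if it misses q, it meets U₀ and U₁ in two different points and adds at most
-- r − 1. Hence the family covers at most 2r + 1 + (r − 2)r = r² + 1 points, and fewer
-- unless q lies in every set. As all r² + 1 points are covered, q ∈ ⋂ Uᵢ ⊆ U₀ ∩ U₁ = {q}.
module Submission where

open import Data.Fin using (Fin; zero; suc; _≟_)
open import Data.Fin.Subset
open import Data.Fin.Subset.Properties
open import Data.Vec using ([]; _∷_)
open import Data.Nat using (ℕ; zero; suc; _*_; _+_; _<_; _≤_; z≤n; s≤s)
open import Data.Nat.Properties
  using ( ≤-reflexive; ≤-trans; ≤-antisym; ≤-pred; <-irrefl; ≤⇒≯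
        ; +-assoc; +-comm; +-suc; +-cancelʳ-≡; +-monoˡ-≤; +-monoʳ-≤; module ≤-Reasoning)
open import Data.Nat.Tactic.RingSolver using (solve-∀)
open import Data.Product using (∃; _,_; proj₁; proj₂)
open import Data.Vec.Functional using (toList)
open import Function using (_∘_)
open import Relation.Binary.PropositionalEquality
open import Relation.Nullary using (yes; no; contradiction)
open import Relation.Nullary.Decidable using (decidable-stable)

open import Defs

variable
  n k s t : ℕ

x∈p⇒0<∣p∣ : {x : Fin n} {p : Subset n} → x ∈ p → 0 < ∣ p ∣
x∈p⇒0<∣p∣ x∈p = ≤-trans (s≤s z≤n) (x∈p⇒∣p-x∣<∣p∣ x∈p)

x,y∈p⇒1<∣p∣ : {x y : Fin n} {p : Subset n} → x ∈ p → y ∈ p → x ≢ y → 1 < ∣ p ∣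
x,y∈p⇒1<∣p∣ x∈p y∈p x≢y =
  ≤-trans (s≤s (x∈p⇒0<∣p∣ (x∈p∧x≢y⇒x∈p-y y∈p (x≢y ∘ sym)))) (x∈p⇒∣p-x∣<∣p∣ x∈p)

∣p∣≡1⇒x≡y : {x y : Fin n} {p : Subset n} → ∣ p ∣ ≡ 1 → x ∈ p → y ∈ p → x ≡ y
∣p∣≡1⇒x≡y ∣p∣≡1 x∈p y∈p =
  decidable-stable (_ ≟ _) (λ x≢y → <-irrefl (sym ∣p∣≡1) (x,y∈p⇒1<∣p∣ x∈p y∈p x≢y))

0<∣p∣⇒nonempty : {p : Subset n} → 0 < ∣ p ∣ → Nonempty p
0<∣p∣⇒nonempty {n} {p} 0<∣p∣ with nonempty? p
... | yes x∈p = x∈p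
... | no empty = contradiction (subst (0 <_) ∣p∣≡0 0<∣p∣) λ ()
  where
  ∣p∣≡0 : ∣ p ∣ ≡ 0
  ∣p∣≡0 = trans (cong ∣_∣ (Empty-unique empty)) (∣⊥∣≡0 n)

∀x∈p⇒∣p∣≡n : {p : Subset n} → (∀ x → x ∈ p) → ∣ p ∣ ≡ n
∀x∈p⇒∣p∣≡n ∀x∈p = trans (cong ∣_∣ (⊆-antisym ⊆⊤ (λ {x} _ → ∀x∈p x))) (∣⊤∣≡n _)

∣p∪q∣+∣p∩q∣≡∣p∣+∣q∣ : ∀ (p q : Subset n) → ∣ p ∪ q ∣ + ∣ p ∩ q ∣ ≡ ∣ p ∣ + ∣ q ∣
∣p∪q∣+∣p∩q∣≡∣p∣+∣q∣ [] [] = refl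
∣p∪q∣+∣p∩q∣≡∣p∣+∣q∣ (inside ∷ p) (inside ∷ q) = cong suc (begin
  ∣ p ∪ q ∣ + suc ∣ p ∩ q ∣   ≡⟨ +-suc ∣ p ∪ q ∣ ∣ p ∩ q ∣ ⟩
  suc (∣ p ∪ q ∣ + ∣ p ∩ q ∣) ≡⟨ cong suc (∣p∪q∣+∣p∩q∣≡∣p∣+∣q∣ p q) ⟩
  suc (∣ p ∣ + ∣ q ∣)         ≡⟨ +-suc ∣ p ∣ ∣ q ∣ ⟨
  ∣ p ∣ + suc ∣ q ∣           ∎)
  where open ≡-Reasoning
∣p∪q∣+∣p∩q∣≡∣p∣+∣q∣ (inside ∷ p) (outside ∷ q) = cong suc (∣p∪q∣+∣p∩q∣≡∣p∣+∣q∣ p q)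
∣p∪q∣+∣p∩q∣≡∣p∣+∣q∣ (outside ∷ p) (inside ∷ q) =
  trans (cong suc (∣p∪q∣+∣p∩q∣≡∣p∣+∣q∣ p q)) (sym (+-suc ∣ p ∣ ∣ q ∣))
∣p∪q∣+∣p∩q∣≡∣p∣+∣q∣ (outside ∷ p) (outside ∷ q) = ∣p∪q∣+∣p∩q∣≡∣p∣+∣q∣ p q

t≤∣p∩q∣⇒t+∣p∪q∣≤∣p∣+∣q∣ : ∀ (p q : Subset n) → t ≤ ∣ p ∩ q ∣ →
                           t + ∣ p ∪ q ∣ ≤ ∣ p ∣ + ∣ q ∣
t≤∣p∩q∣⇒t+∣p∪q∣≤∣p∣+∣q∣ {t = t} p q t≤∣p∩q∣ = begin
  t + ∣ p ∪ q ∣         ≤⟨ +-monoˡ-≤ ∣ p ∪ q ∣ t≤∣p∩q∣ ⟩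
  ∣ p ∩ q ∣ + ∣ p ∪ q ∣ ≡⟨ +-comm ∣ p ∩ q ∣ ∣ p ∪ q ∣ ⟩
  ∣ p ∪ q ∣ + ∣ p ∩ q ∣ ≡⟨ ∣p∪q∣+∣p∩q∣≡∣p∣+∣q∣ p q ⟩
  ∣ p ∣ + ∣ q ∣         ∎
  where open ≤-Reasoning

∩-monoʳ-⊆ : {p q r : Subset n} → q ⊆ r → p ∩ q ⊆ p ∩ r
∩-monoʳ-⊆ {p = p} {q = q} q⊆r x∈p∩q with x∈p∩q⁻ p q x∈p∩q
... | x∈p , x∈q = x∈p∩q⁺ (x∈p , q⊆r x∈q)

∣q∩r∣≡1⇒1<∣p∩[q∪r]∣ : {x : Fin n} {p q r : Subset n} → ∣ q ∩ r ∣ ≡ 1 → x ∈ q ∩ r → x ∉ p →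
                       Nonempty (p ∩ q) → Nonempty (p ∩ r) → 1 < ∣ p ∩ (q ∪ r) ∣
∣q∩r∣≡1⇒1<∣p∩[q∪r]∣ {x = x} {p} {q} {r} ∣q∩r∣≡1 x∈q∩r x∉p (a , a∈p∩q) (b , b∈p∩r) =
  x,y∈p⇒1<∣p∣ (∩-monoʳ-⊆ (p⊆p∪q r) a∈p∩q) (∩-monoʳ-⊆ (q⊆p∪q q r) b∈p∩r) a≢b
  where
  a≢b : a ≢ b
  a≢b refl with x∈p∩q⁻ p q a∈p∩q | x∈p∩q⁻ p r b∈p∩r
  ... | a∈p , a∈q | _ , a∈r =
    x∉p (subst (_∈ p) (∣p∣≡1⇒x≡y ∣q∩r∣≡1 (x∈p∩q⁺ (a∈q , a∈r)) x∈q∩r) a∈p)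

⋃ᶠ : (Fin k → Subset n) → Subset n
⋃ᶠ V = ⋃ (toList V)

x∈⋃ᶠ⁺ : {x : Fin n} (V : Fin k → Subset n) (i : Fin k) → x ∈ V i → x ∈ ⋃ᶠ V
x∈⋃ᶠ⁺ V zero x∈V₀ = p⊆p∪q (⋃ᶠ (V ∘ suc)) x∈V₀
x∈⋃ᶠ⁺ V (suc i) x∈Vᵢ = q⊆p∪q (V zero) (⋃ᶠ (V ∘ suc)) (x∈⋃ᶠ⁺ (V ∘ suc) i x∈Vᵢ)

cover⇒∣⋃ᶠ∣≡n : (V : Fin k → Subset n) → (∀ x → ∃ λ i → x ∈ V i) → ∣ ⋃ᶠ V ∣ ≡ n
cover⇒∣⋃ᶠ∣≡n V cover = ∀x∈p⇒∣p∣≡n (λ x → let i , x∈Vᵢ = cover x in x∈⋃ᶠ⁺ V i x∈Vᵢ)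

x∈⋂ᶠ⁺ : {x : Fin n} (V : Fin k → Subset n) → (∀ i → x ∈ V i) → x ∈ ⋂ᶠ V
x∈⋂ᶠ⁺ {k = zero} V _ = ∈⊤
x∈⋂ᶠ⁺ {k = suc k} V x∈V = x∈p∩q⁺ (x∈V zero , x∈⋂ᶠ⁺ (V ∘ suc) (x∈V ∘ suc))

⋂ᶠ⊆ : (V : Fin k → Subset n) (i : Fin k) → ⋂ᶠ V ⊆ V i
⋂ᶠ⊆ V zero x∈⋂ = proj₁ (x∈p∩q⁻ (V zero) _ x∈⋂)
⋂ᶠ⊆ V (suc i) x∈⋂ = ⋂ᶠ⊆ (V ∘ suc) i (proj₂ (x∈p∩q⁻ (V zero) _ x∈⋂))

module _ (B : Subset n) where

  adjoin-≤ : (V₀ R : Subset n) → ∣ V₀ ∣ ≡ suc s → t ≤ ∣ V₀ ∩ B ∣ →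
             t + ∣ (V₀ ∪ R) ∪ B ∣ ≤ suc s + ∣ R ∪ B ∣
  adjoin-≤ {s = s} {t = t} V₀ R ∣V₀∣≡1+s t≤∣V₀∩B∣ = begin
    t + ∣ (V₀ ∪ R) ∪ B ∣ ≡⟨ cong (λ W → t + ∣ W ∣) (∪-assoc V₀ R B) ⟩
    t + ∣ V₀ ∪ (R ∪ B) ∣ ≤⟨ t≤∣p∩q∣⇒t+∣p∪q∣≤∣p∣+∣q∣ V₀ (R ∪ B) t≤∣V₀∩[R∪B]∣ ⟩
    ∣ V₀ ∣ + ∣ R ∪ B ∣   ≡⟨ cong (_+ ∣ R ∪ B ∣) ∣V₀∣≡1+s ⟩
    suc s + ∣ R ∪ B ∣    ∎
    where
    open ≤-Reasoning
    t≤∣V₀∩[R∪B]∣ : t ≤ ∣ V₀ ∩ (R ∪ B) ∣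
    t≤∣V₀∩[R∪B]∣ =
      ≤-trans t≤∣V₀∩B∣ (p⊆q⇒∣p∣≤∣q∣ {p = V₀ ∩ B} {q = V₀ ∩ (R ∪ B)} (∩-monoʳ-⊆ (q⊆p∪q R B)))

  ∣⋃ᶠ∪B∣≤ : (V : Fin k → Subset n) → (∀ j → ∣ V j ∣ ≡ suc s) → (∀ j → 0 < ∣ V j ∩ B ∣) →
            ∣ ⋃ᶠ V ∪ B ∣ ≤ k * s + ∣ B ∣
  ∣⋃ᶠ∪B∣≤ {k = zero} V _ _ = ≤-reflexive (cong ∣_∣ (∪-identityˡ B))
  ∣⋃ᶠ∪B∣≤ {k = suc k} {s = s} V ∣V∣≡1+s 0<∣V∩B∣ = ≤-pred (begin
    suc ∣ ⋃ᶠ V ∪ B ∣              ≤⟨ adjoin-≤ (V zero) (⋃ᶠ (V ∘ suc)) (∣V∣≡1+s zero) (0<∣V∩B∣ zero) ⟩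
    suc s + ∣ ⋃ᶠ (V ∘ suc) ∪ B ∣ ≤⟨ +-monoʳ-≤ (suc s) ∣⋃ᶠV′∪B∣≤ ⟩
    suc s + (k * s + ∣ B ∣)      ≡⟨ cong suc (+-assoc s (k * s) ∣ B ∣) ⟨
    suc (suc k * s + ∣ B ∣)      ∎)
    where
    open ≤-Reasoning
    ∣⋃ᶠV′∪B∣≤ : ∣ ⋃ᶠ (V ∘ suc) ∪ B ∣ ≤ k * s + ∣ B ∣
    ∣⋃ᶠV′∪B∣≤ = ∣⋃ᶠ∪B∣≤ (V ∘ suc) (∣V∣≡1+s ∘ suc) (0<∣V∩B∣ ∘ suc)

  ∣⋃ᶠ∪B∣< : (V : Fin k → Subset n) → (∀ j → ∣ V j ∣ ≡ suc s) → (∀ j → 0 < ∣ V j ∩ B ∣) →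
            ∀ j → 1 < ∣ V j ∩ B ∣ → ∣ ⋃ᶠ V ∪ B ∣ < k * s + ∣ B ∣
  ∣⋃ᶠ∪B∣< {k = suc k} {s = s} V ∣V∣≡1+s 0<∣V∩B∣ j 1<∣Vⱼ∩B∣ = ≤-pred (begin
    2 + ∣ ⋃ᶠ V ∪ B ∣         ≤⟨ 2+∣⋃ᶠV∪B∣≤ j 1<∣Vⱼ∩B∣ ⟩
    suc s + (k * s + ∣ B ∣)  ≡⟨ cong suc (+-assoc s (k * s) ∣ B ∣) ⟨
    suc (suc k * s + ∣ B ∣)  ∎)
    where
    open ≤-Reasoning
    Y : Subset n
    Y = ⋃ᶠ (V ∘ suc) ∪ B

    adjoin-V₀ : t ≤ ∣ V zero ∩ B ∣ → t + ∣ ⋃ᶠ V ∪ B ∣ ≤ suc s + ∣ Y ∣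
    adjoin-V₀ = adjoin-≤ (V zero) (⋃ᶠ (V ∘ suc)) (∣V∣≡1+s zero)

    2+∣⋃ᶠV∪B∣≤ : ∀ j → 1 < ∣ V j ∩ B ∣ → 2 + ∣ ⋃ᶠ V ∪ B ∣ ≤ suc s + (k * s + ∣ B ∣)
    2+∣⋃ᶠV∪B∣≤ zero 1<∣V₀∩B∣ = begin
      2 + ∣ ⋃ᶠ V ∪ B ∣        ≤⟨ adjoin-V₀ 1<∣V₀∩B∣ ⟩
      suc s + ∣ Y ∣           ≤⟨ +-monoʳ-≤ (suc s) ∣Y∣≤ ⟩
      suc s + (k * s + ∣ B ∣) ∎
      where
      ∣Y∣≤ : ∣ Y ∣ ≤ k * s + ∣ B ∣
      ∣Y∣≤ = ∣⋃ᶠ∪B∣≤ (V ∘ suc) (∣V∣≡1+s ∘ suc) (0<∣V∩B∣ ∘ suc)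
    2+∣⋃ᶠV∪B∣≤ (suc j) 1<∣Vⱼ∩B∣ = begin
      2 + ∣ ⋃ᶠ V ∪ B ∣        ≤⟨ s≤s (adjoin-V₀ (0<∣V∩B∣ zero)) ⟩
      suc (suc s + ∣ Y ∣)     ≡⟨ +-suc (suc s) ∣ Y ∣ ⟨
      suc s + suc ∣ Y ∣       ≤⟨ +-monoʳ-≤ (suc s) ∣Y∣< ⟩
      suc s + (k * s + ∣ B ∣) ∎
      where
      ∣Y∣< : ∣ Y ∣ < k * s + ∣ B ∣
      ∣Y∣< = ∣⋃ᶠ∪B∣< (V ∘ suc) (∣V∣≡1+s ∘ suc) (0<∣V∩B∣ ∘ suc) j 1<∣Vⱼ∩B∣

tight-union⇒x∈V : {x : Fin n} (U₀ U₁ : Subset n) (V : Fin k → Subset n) →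
                   ∣ U₀ ∣ ≡ suc s → ∣ U₁ ∣ ≡ suc s → ∣ U₀ ∩ U₁ ∣ ≡ 1 → x ∈ U₀ ∩ U₁ →
                   (∀ j → ∣ V j ∣ ≡ suc s) →
                   (∀ j → Nonempty (V j ∩ U₀)) → (∀ j → Nonempty (V j ∩ U₁)) →
                   k * s + suc (s + s) ≤ ∣ ⋃ᶠ V ∪ (U₀ ∪ U₁) ∣ → ∀ j → x ∈ V j
tight-union⇒x∈V {k = k} {s = s} {x = x} U₀ U₁ V
                 ∣U₀∣≡1+s ∣U₁∣≡1+s ∣U₀∩U₁∣≡1 x∈U₀∩U₁ ∣V∣≡1+s V∩U₀≢∅ V∩U₁≢∅ tight j =
  decidable-stable (x ∈? V j) λ x∉Vⱼ →
    ≤⇒≯ (≤-trans (≤-reflexive (cong (k * s +_) ∣U₀∪U₁∣≡1+2s)) tight)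
        (∣⋃ᶠ∪B∣< (U₀ ∪ U₁) V ∣V∣≡1+s 0<∣V∩[U₀∪U₁]∣ j
          (∣q∩r∣≡1⇒1<∣p∩[q∪r]∣ ∣U₀∩U₁∣≡1 x∈U₀∩U₁ x∉Vⱼ (V∩U₀≢∅ j) (V∩U₁≢∅ j)))
  where
  ∣U₀∪U₁∣≡1+2s : ∣ U₀ ∪ U₁ ∣ ≡ suc (s + s)
  ∣U₀∪U₁∣≡1+2s = +-cancelʳ-≡ 1 _ _ (begin
    ∣ U₀ ∪ U₁ ∣ + 1           ≡⟨ cong (∣ U₀ ∪ U₁ ∣ +_) ∣U₀∩U₁∣≡1 ⟨
    ∣ U₀ ∪ U₁ ∣ + ∣ U₀ ∩ U₁ ∣ ≡⟨ ∣p∪q∣+∣p∩q∣≡∣p∣+∣q∣ U₀ U₁ ⟩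
    ∣ U₀ ∣ + ∣ U₁ ∣           ≡⟨ cong₂ _+_ ∣U₀∣≡1+s ∣U₁∣≡1+s ⟩
    suc s + suc s             ≡⟨ cong suc (+-suc s s) ⟩
    suc (suc (s + s))         ≡⟨ +-comm 1 (suc (s + s)) ⟩
    suc (s + s) + 1           ∎)
    where open ≡-Reasoning

  0<∣V∩[U₀∪U₁]∣ : ∀ j → 0 < ∣ V j ∩ (U₀ ∪ U₁) ∣
  0<∣V∩[U₀∪U₁]∣ j =
    let y , y∈Vⱼ∩U₀ = V∩U₀≢∅ j in x∈p⇒0<∣p∣ (∩-monoʳ-⊆ (p⊆p∪q U₁) y∈Vⱼ∩U₀)

k*r+[1+2r]≡r*r+1 : ∀ k → k * (2 + k) + suc ((2 + k) + (2 + k)) ≡ (2 + k) * (2 + k) + 1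
k*r+[1+2r]≡r*r+1 = solve-∀

lemma6 : (r : ℕ) → 2 < r →
         (U : Fin r → Subset (r * r + 1)) →
         (∀ (x : Fin (r * r + 1)) → ∃ λ i → x ∈ U i) →
         (∀ i → ∣ U i ∣ ≡ r + 1) →
         (∀ i j → i ≢ j → ∣ U i ∩ U j ∣ ≡ 1) →
         ∣ ⋂ᶠ U ∣ ≡ 1
lemma6 zero () _ _ _ _
lemma6 (suc zero) (s≤s ()) _ _ _ _
lemma6 r@(suc (suc k)) _ U cover ∣U∣≡r+1 ∣U∩U∣≡1 =
  ≤-antisym (≤-trans (p⊆q⇒∣p∣≤∣q∣ {p = ⋂ᶠ U} {q = U₀ ∩ U₁} ⋂ᶠU⊆U₀∩U₁) (≤-reflexive ∣U₀∩U₁∣≡1))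
            (x∈p⇒0<∣p∣ (x∈⋂ᶠ⁺ U q∈U))
  where
  U₀ U₁ : Subset (r * r + 1)
  U₀ = U zero
  U₁ = U (suc zero)

  V : Fin k → Subset (r * r + 1)
  V j = U (suc (suc j))

  ∣U∣≡1+r : ∀ i → ∣ U i ∣ ≡ suc r
  ∣U∣≡1+r i = trans (∣U∣≡r+1 i) (+-comm r 1)

  ∣U₀∩U₁∣≡1 : ∣ U₀ ∩ U₁ ∣ ≡ 1
  ∣U₀∩U₁∣≡1 = ∣U∩U∣≡1 zero (suc zero) (λ ())

  meets : ∀ i j → i ≢ j → Nonempty (U i ∩ U j)
  meets i j i≢j = 0<∣p∣⇒nonempty (≤-reflexive (sym (∣U∩U∣≡1 i j i≢j)))

  q : Fin (r * r + 1)
  q = proj₁ (meets zero (suc zero) (λ ()))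

  q∈U₀∩U₁ : q ∈ U₀ ∩ U₁
  q∈U₀∩U₁ = proj₂ (meets zero (suc zero) (λ ()))

  tight : k * r + suc (r + r) ≤ ∣ ⋃ᶠ V ∪ (U₀ ∪ U₁) ∣
  tight = ≤-reflexive (begin
    k * r + suc (r + r)      ≡⟨ k*r+[1+2r]≡r*r+1 k ⟩
    r * r + 1                ≡⟨ cover⇒∣⋃ᶠ∣≡n U cover ⟨
    ∣ ⋃ᶠ U ∣                 ≡⟨ cong ∣_∣ (∪-assoc U₀ U₁ (⋃ᶠ V)) ⟨
    ∣ (U₀ ∪ U₁) ∪ ⋃ᶠ V ∣     ≡⟨ cong ∣_∣ (∪-comm (U₀ ∪ U₁) (⋃ᶠ V)) ⟩
    ∣ ⋃ᶠ V ∪ (U₀ ∪ U₁) ∣     ∎)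
    where open ≡-Reasoning

  q∈U : ∀ i → q ∈ U i
  q∈U zero = proj₁ (x∈p∩q⁻ U₀ U₁ q∈U₀∩U₁)
  q∈U (suc zero) = proj₂ (x∈p∩q⁻ U₀ U₁ q∈U₀∩U₁)
  q∈U (suc (suc j)) =
    tight-union⇒x∈V U₀ U₁ V (∣U∣≡1+r zero) (∣U∣≡1+r (suc zero)) ∣U₀∩U₁∣≡1 q∈U₀∩U₁
      (λ j → ∣U∣≡1+r (suc (suc j)))
      (λ j → meets (suc (suc j)) zero (λ ())) (λ j → meets (suc (suc j)) (suc zero) (λ ()))
      tight j

  ⋂ᶠU⊆U₀∩U₁ : ⋂ᶠ U ⊆ U₀ ∩ U₁
  ⋂ᶠU⊆U₀∩U₁ x∈⋂ᶠU = x∈p∩q⁺ (⋂ᶠ⊆ U zero x∈⋂ᶠU , ⋂ᶠ⊆ U (suc zero) x∈⋂ᶠU)
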